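{- Let $(\mathcal C,\otimes,I,\gamma)$ be a symmetric monoidal category, $(\mathcal T,\eta,\mu,\tau)$ a strong monad on it, and $f:X\to\mathcal TY$ a morphism of $\mathcal C$. Then $(X,f)$ is a central cone of $\mathcal T$ at $Y$ if and only if $f$ is central as a morphism of the Kleisli category $\mathcal C_{\mathcal T}$.
   Context: Right strength: $\tau'_{X,Y}=\mathcal T(\gamma_{Y,X})\circ\tau_{Y,X}\circ\gamma_{\mathcal TX,Y}$. A central cone of $\mathcal T$ at an object $X$ is a pair $(Z,\iota)$ with $\iota:Z\to\mathcal TX$ such that for every object $Y$, $\mu_{X\otimes Y}\circ\mathcal T\tau'_{X,Y}\circ\tau_{\mathcal TX,Y}\circ(\iota\otimes\mathrm{id}_{\mathcal TY})=\mu_{X\otimes Y}\circ\mathcal T\tau_{X,Y}\circ\tau'_{X,\mathcal TY}\circ(\iota\otimes\mathrm{id}_{\mathcal TY})$ as morphisms $Z\otimes\mathcal TY\to\mathcal T(X\otimes Y)$. The Kleisli category $\mathcal C_{\mathcal T}$ has morphisms $X\to Y$ the morphisms $X\to\mathcal TY$, composition $g\odot f=\mu\circ\mathcal Tg\circ f$, identities $\eta$. For $f:X\to\mathcal TY$ and an object $W$ set $f\otimes_l W=\tau'_{Y,W}\circ(f\otimes W)$ and $W\otimes_r f=\tau_{W,Y}\circ(W\otimes f)$. A Kleisli morphism $f:X\to\mathcal TY$ is central if for every $f':X'\to\mathcal TY'$, $(Y\otimes_r f')\odot(f\otimes_l X')=(f\otimes_l Y')\odot(X\otimes_r f')$. 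-}

module Defs where

open import Level using (Level; _⊔_) renaming (suc to lsuc)
open import Relation.Binary using (Rel; IsEquivalence)

record Category (o ℓ e : Level) : Set (lsuc (o ⊔ ℓ ⊔ e)) where
  infix  4 _≈_
  infixr 9 _∘_
  infix  6 _⇒_
  field
    Obj : Set o
    _⇒_ : Obj → Obj → Set ℓ
    _≈_ : ∀ {A B} → Rel (A ⇒ B) e
    id  : ∀ {A} → A ⇒ A
    _∘_ : ∀ {A B C} → B ⇒ C → A ⇒ B → A ⇒ C
    equiv     : ∀ {A B} → IsEquivalence (_≈_ {A} {B})
    assoc     : ∀ {A B C D} {f : A ⇒ B} {g : B ⇒ C} {h : C ⇒ D} →
                (h ∘ g) ∘ f ≈ h ∘ (g ∘ f)
    identityˡ : ∀ {A B} {f : A ⇒ B} → id ∘ f ≈ f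
    identityʳ : ∀ {A B} {f : A ⇒ B} → f ∘ id ≈ f
    ∘-resp-≈  : ∀ {A B C} {f h : B ⇒ C} {g i : A ⇒ B} →
                f ≈ h → g ≈ i → f ∘ g ≈ h ∘ i

record SymmetricMonoidalCategory (o ℓ e : Level) : Set (lsuc (o ⊔ ℓ ⊔ e)) where
  field
    category : Category o ℓ e
  open Category category public
  infixr 10 _⊗₀_ _⊗₁_
  field
    _⊗₀_ : Obj → Obj → Obj
    _⊗₁_ : ∀ {A B C D} → A ⇒ B → C ⇒ D → (A ⊗₀ C) ⇒ (B ⊗₀ D)
    ⊗-identity     : ∀ {A B} → id {A} ⊗₁ id {B} ≈ id
    ⊗-homomorphism : ∀ {A B C D E F} {f : B ⇒ C} {g : A ⇒ B} {h : E ⇒ F} {i : D ⇒ E} →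
                     (f ∘ g) ⊗₁ (h ∘ i) ≈ (f ⊗₁ h) ∘ (g ⊗₁ i)
    ⊗-resp-≈       : ∀ {A B C D} {f f′ : A ⇒ B} {g g′ : C ⇒ D} →
                     f ≈ f′ → g ≈ g′ → f ⊗₁ g ≈ f′ ⊗₁ g′
    unit : Obj
    α⇒ : ∀ {A B C} → (A ⊗₀ B) ⊗₀ C ⇒ A ⊗₀ (B ⊗₀ C)
    α⇐ : ∀ {A B C} → A ⊗₀ (B ⊗₀ C) ⇒ (A ⊗₀ B) ⊗₀ C
    α-isoˡ : ∀ {A B C} → α⇐ {A} {B} {C} ∘ α⇒ ≈ id
    α-isoʳ : ∀ {A B C} → α⇒ {A} {B} {C} ∘ α⇐ ≈ id
    α-natural : ∀ {A B C D E F} {f : A ⇒ B} {g : C ⇒ D} {h : E ⇒ F} →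
                α⇒ ∘ ((f ⊗₁ g) ⊗₁ h) ≈ (f ⊗₁ (g ⊗₁ h)) ∘ α⇒
    λ⇒ : ∀ {A} → unit ⊗₀ A ⇒ A
    λ⇐ : ∀ {A} → A ⇒ unit ⊗₀ A
    λ-isoˡ : ∀ {A} → λ⇐ {A} ∘ λ⇒ ≈ id
    λ-isoʳ : ∀ {A} → λ⇒ {A} ∘ λ⇐ ≈ id
    λ-natural : ∀ {A B} {f : A ⇒ B} → λ⇒ ∘ (id ⊗₁ f) ≈ f ∘ λ⇒
    ρ⇒ : ∀ {A} → A ⊗₀ unit ⇒ A
    ρ⇐ : ∀ {A} → A ⇒ A ⊗₀ unit
    ρ-isoˡ : ∀ {A} → ρ⇐ {A} ∘ ρ⇒ ≈ id
    ρ-isoʳ : ∀ {A} → ρ⇒ {A} ∘ ρ⇐ ≈ id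
    ρ-natural : ∀ {A B} {f : A ⇒ B} → ρ⇒ ∘ (f ⊗₁ id) ≈ f ∘ ρ⇒
    triangle : ∀ {A B} → (id {A} ⊗₁ λ⇒ {B}) ∘ α⇒ ≈ ρ⇒ ⊗₁ id
    pentagon : ∀ {A B C D} →
               (id {A} ⊗₁ α⇒ {B} {C} {D}) ∘ α⇒ ∘ (α⇒ ⊗₁ id) ≈ α⇒ ∘ α⇒
    γ : ∀ {A B} → A ⊗₀ B ⇒ B ⊗₀ A
    γ-natural    : ∀ {A B C D} {f : A ⇒ B} {g : C ⇒ D} →
                   γ ∘ (f ⊗₁ g) ≈ (g ⊗₁ f) ∘ γ
    γ-involutive : ∀ {A B} → γ {B} {A} ∘ γ {A} {B} ≈ id
    hexagon      : ∀ {A B C} →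
                   α⇒ {B} {C} {A} ∘ γ ∘ α⇒ ≈ (id ⊗₁ γ) ∘ α⇒ ∘ (γ ⊗₁ id)

record StrongMonad {o ℓ e} (𝒞 : SymmetricMonoidalCategory o ℓ e) : Set (o ⊔ ℓ ⊔ e) where
  open SymmetricMonoidalCategory 𝒞
  field
    T₀ : Obj → Obj
    T₁ : ∀ {A B} → A ⇒ B → T₀ A ⇒ T₀ B
    T-identity     : ∀ {A} → T₁ (id {A}) ≈ id
    T-homomorphism : ∀ {A B C} {f : A ⇒ B} {g : B ⇒ C} → T₁ (g ∘ f) ≈ T₁ g ∘ T₁ f
    T-resp-≈       : ∀ {A B} {f g : A ⇒ B} → f ≈ g → T₁ f ≈ T₁ g
    η : ∀ {A} → A ⇒ T₀ A
    μ : ∀ {A} → T₀ (T₀ A) ⇒ T₀ A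
    η-natural : ∀ {A B} {f : A ⇒ B} → η ∘ f ≈ T₁ f ∘ η
    μ-natural : ∀ {A B} {f : A ⇒ B} → μ ∘ T₁ (T₁ f) ≈ T₁ f ∘ μ
    μ-assoc     : ∀ {A} → μ {A} ∘ T₁ μ ≈ μ ∘ μ
    μ-identityˡ : ∀ {A} → μ {A} ∘ T₁ η ≈ id
    μ-identityʳ : ∀ {A} → μ {A} ∘ η ≈ id
    τ : ∀ {A B} → A ⊗₀ T₀ B ⇒ T₀ (A ⊗₀ B)
    τ-natural : ∀ {A B C D} {f : A ⇒ B} {g : C ⇒ D} →
                τ ∘ (f ⊗₁ T₁ g) ≈ T₁ (f ⊗₁ g) ∘ τ
    τ-unit  : ∀ {A} → T₁ λ⇒ ∘ τ {unit} {A} ≈ λ⇒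
    τ-assoc : ∀ {A B C} →
              T₁ α⇒ ∘ τ {A ⊗₀ B} {C} ≈ τ {A} {B ⊗₀ C} ∘ (id ⊗₁ τ) ∘ α⇒
    τ-η     : ∀ {A B} → τ ∘ (id {A} ⊗₁ η {B}) ≈ η
    τ-μ     : ∀ {A B} → τ ∘ (id {A} ⊗₁ μ {B}) ≈ μ ∘ T₁ τ ∘ τ

module _ {o ℓ e} {𝒞 : SymmetricMonoidalCategory o ℓ e} (M : StrongMonad 𝒞) where
  open SymmetricMonoidalCategory 𝒞
  open StrongMonad M

  τ′ : ∀ {X Y} → T₀ X ⊗₀ Y ⇒ T₀ (X ⊗₀ Y)
  τ′ {X} {Y} = T₁ (γ {Y} {X}) ∘ τ {Y} {X} ∘ γ {T₀ X} {Y}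

  IsCentralCone : ∀ {Z X} → Z ⇒ T₀ X → Set (o ⊔ e)
  IsCentralCone {Z} {X} ι = ∀ (Y : Obj) →
    μ {X ⊗₀ Y} ∘ T₁ (τ′ {X} {Y}) ∘ τ {T₀ X} {Y} ∘ (ι ⊗₁ id {T₀ Y})
      ≈ μ {X ⊗₀ Y} ∘ T₁ (τ {X} {Y}) ∘ τ′ {X} {T₀ Y} ∘ (ι ⊗₁ id {T₀ Y})

  infixr 9 _⊙_
  _⊙_ : ∀ {A B C} → B ⇒ T₀ C → A ⇒ T₀ B → A ⇒ T₀ C
  g ⊙ f = μ ∘ T₁ g ∘ f

  _⊗ₗ_ : ∀ {X Y} → X ⇒ T₀ Y → (W : Obj) → X ⊗₀ W ⇒ T₀ (Y ⊗₀ W)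
  _⊗ₗ_ {X} {Y} f W = τ′ {Y} {W} ∘ (f ⊗₁ id {W})

  _⊗ᵣ_ : ∀ {X Y} → (W : Obj) → X ⇒ T₀ Y → W ⊗₀ X ⇒ T₀ (W ⊗₀ Y)
  _⊗ᵣ_ {X} {Y} W f = τ {W} {Y} ∘ (id {W} ⊗₁ f)

  IsKleisliCentral : ∀ {X Y} → X ⇒ T₀ Y → Set (o ⊔ ℓ ⊔ e)
  IsKleisliCentral {X} {Y} f = ∀ {X′ Y′} (f′ : X′ ⇒ T₀ Y′) →
    (Y ⊗ᵣ f′) ⊙ (f ⊗ₗ X′) ≈ (f ⊗ₗ Y′) ⊙ (X ⊗ᵣ f′)

{-# OPTIONS --safe #-}
module Submission where

-- Using the naturality of τ and τ′, each of the two Kleisli composites in the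
-- centrality condition for f against f′ : X′ → T Y′ becomes one side of the
-- central-cone equation at Y′, precomposed with id ⊗ f′. So the cone equation
-- implies centrality, and centrality against f′ = id : T W → T W is the cone
-- equation at W.

open import Defs hiding (τ′; _⊙_; _⊗ₗ_; _⊗ᵣ_)
import Defs
open import Level using (Level)
open import Data.Product using (_×_; _,_)
open SymmetricMonoidalCategory using (_⇒_)
open StrongMonad using (T₀)
open import Relation.Binary using (Setoid; IsEquivalence)
import Relation.Binary.Reasoning.Setoid as SetoidReasoning

module CentralCones {o ℓ e} (𝒞 : SymmetricMonoidalCategory o ℓ e) (M : StrongMonad 𝒞) where
  open SymmetricMonoidalCategory 𝒞 hiding (_⇒_)
  open SymmetricMonoidalCategory 𝒞 using () renaming (_⇒_ to _⇛_)
  open StrongMonad M hiding (T₀)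
  open StrongMonad M using () renaming (T₀ to T)

  hom-setoid : Obj → Obj → Setoid ℓ e
  hom-setoid A B = record { Carrier = A ⇛ B ; _≈_ = _≈_ ; isEquivalence = equiv }

  module _ {A B : Obj} where
    open IsEquivalence (equiv {A} {B}) public
      renaming (refl to ≈-refl; sym to ≈-sym; trans to ≈-trans)

  τ′ : ∀ {A B} → T A ⊗₀ B ⇛ T (A ⊗₀ B)
  τ′ = Defs.τ′ M

  infixr 9 _⊙_
  _⊙_ : ∀ {A B C} → B ⇛ T C → A ⇛ T B → A ⇛ T C
  _⊙_ = Defs._⊙_ M

  _⊗ₗ_ : ∀ {A B} → A ⇛ T B → (W : Obj) → A ⊗₀ W ⇛ T (B ⊗₀ W)
  _⊗ₗ_ = Defs._⊗ₗ_ M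

  _⊗ᵣ_ : ∀ {A B} → (W : Obj) → A ⇛ T B → W ⊗₀ A ⇛ T (W ⊗₀ B)
  _⊗ᵣ_ = Defs._⊗ᵣ_ M

  infixr 9 _⟩∘⟨_
  _⟩∘⟨_ : ∀ {A B C} {f h : B ⇛ C} {g i : A ⇛ B} → f ≈ h → g ≈ i → f ∘ g ≈ h ∘ i
  _⟩∘⟨_ = ∘-resp-≈

  extendʳ : ∀ {A B C D B′} {a : B ⇛ C} {b : A ⇛ B} {c : B′ ⇛ C} {d : A ⇛ B′} {x : D ⇛ A} →
            a ∘ b ≈ c ∘ d → a ∘ b ∘ x ≈ c ∘ d ∘ x
  extendʳ p = ≈-trans (≈-sym assoc) (≈-trans (p ⟩∘⟨ ≈-refl) assoc)

  assoc³ : ∀ {A B C D E F} {a : E ⇛ F} {b : D ⇛ E} {c : C ⇛ D} {d : B ⇛ C} {x : A ⇛ B} →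
           (a ∘ b ∘ c ∘ d) ∘ x ≈ a ∘ b ∘ c ∘ d ∘ x
  assoc³ = ≈-trans assoc (≈-refl ⟩∘⟨ ≈-trans assoc (≈-refl ⟩∘⟨ assoc))

  T-∘-split : ∀ {A B C D} {g : B ⇛ C} {h : A ⇛ B} {x : D ⇛ T A} →
              T₁ (g ∘ h) ∘ x ≈ T₁ g ∘ T₁ h ∘ x
  T-∘-split = ≈-trans (T-homomorphism ⟩∘⟨ ≈-refl) assoc

  ∘-id⊗id : ∀ {A B C} {f : A ⊗₀ B ⇛ C} → f ∘ (id ⊗₁ id) ≈ f
  ∘-id⊗id = ≈-trans (≈-refl ⟩∘⟨ ⊗-identity) identityʳ

  ⊗-interchange : ∀ {A B C D} {f : A ⇛ B} {g : C ⇛ D} →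
                  (id ⊗₁ g) ∘ (f ⊗₁ id) ≈ (f ⊗₁ id) ∘ (id ⊗₁ g)
  ⊗-interchange = ≈-trans (≈-sym ⊗-homomorphism)
    (≈-trans (⊗-resp-≈ (≈-trans identityˡ (≈-sym identityʳ)) (≈-trans identityʳ (≈-sym identityˡ)))
             ⊗-homomorphism)

  τ-naturalˡ : ∀ {A B C} {g : A ⇛ B} → T₁ (g ⊗₁ id {C}) ∘ τ ≈ τ ∘ (g ⊗₁ id)
  τ-naturalˡ = ≈-trans (≈-sym τ-natural) (≈-refl ⟩∘⟨ ⊗-resp-≈ ≈-refl T-identity)

  τ′-naturalʳ : ∀ {A B C} {g : B ⇛ C} → T₁ (id {A} ⊗₁ g) ∘ τ′ ≈ τ′ ∘ (id ⊗₁ g)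
  τ′-naturalʳ {A} {g = g} = begin
      T₁ (id ⊗₁ g) ∘ T₁ γ ∘ τ ∘ γ  ≈⟨ extendʳ Tγ-natural ⟩
      T₁ γ ∘ T₁ (g ⊗₁ id) ∘ τ ∘ γ  ≈⟨ ≈-refl ⟩∘⟨ extendʳ τ-naturalˡ ⟩
      T₁ γ ∘ τ ∘ (g ⊗₁ id) ∘ γ     ≈⟨ ≈-refl ⟩∘⟨ ≈-refl ⟩∘⟨ ≈-sym γ-natural ⟩
      T₁ γ ∘ τ ∘ γ ∘ (id ⊗₁ g)     ≈⟨ ≈-sym (≈-trans assoc (≈-refl ⟩∘⟨ assoc)) ⟩
      (T₁ γ ∘ τ ∘ γ) ∘ (id ⊗₁ g)   ∎
    where
    open SetoidReasoning (hom-setoid _ _)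
    Tγ-natural : T₁ (id ⊗₁ g) ∘ T₁ γ ≈ T₁ γ ∘ T₁ (g ⊗₁ id {A})
    Tγ-natural = ≈-trans (≈-sym T-homomorphism) (≈-trans (T-resp-≈ (≈-sym γ-natural)) T-homomorphism)

  ⊙-⊗ₗ-⊗ᵣ : ∀ {X Y X′ Y′} (f : X ⇛ T Y) (f′ : X′ ⇛ T Y′) →
            (f ⊗ₗ Y′) ⊙ (X ⊗ᵣ f′)
              ≈ (μ ∘ T₁ τ′ ∘ τ ∘ (f ⊗₁ id)) ∘ (id ⊗₁ f′)
  ⊙-⊗ₗ-⊗ᵣ f f′ = begin
      μ ∘ T₁ (τ′ ∘ (f ⊗₁ id)) ∘ τ ∘ (id ⊗₁ f′)   ≈⟨ ≈-refl ⟩∘⟨ T-∘-split ⟩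
      μ ∘ T₁ τ′ ∘ T₁ (f ⊗₁ id) ∘ τ ∘ (id ⊗₁ f′)  ≈⟨ ≈-refl ⟩∘⟨ ≈-refl ⟩∘⟨ extendʳ τ-naturalˡ ⟩
      μ ∘ T₁ τ′ ∘ τ ∘ (f ⊗₁ id) ∘ (id ⊗₁ f′)     ≈⟨ ≈-sym assoc³ ⟩
      (μ ∘ T₁ τ′ ∘ τ ∘ (f ⊗₁ id)) ∘ (id ⊗₁ f′)   ∎
    where open SetoidReasoning (hom-setoid _ _)

  ⊙-⊗ᵣ-⊗ₗ : ∀ {X Y X′ Y′} (f : X ⇛ T Y) (f′ : X′ ⇛ T Y′) →
            (Y ⊗ᵣ f′) ⊙ (f ⊗ₗ X′)
              ≈ (μ ∘ T₁ τ ∘ τ′ ∘ (f ⊗₁ id)) ∘ (id ⊗₁ f′)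
  ⊙-⊗ᵣ-⊗ₗ f f′ = begin
      μ ∘ T₁ (τ ∘ (id ⊗₁ f′)) ∘ τ′ ∘ (f ⊗₁ id)   ≈⟨ ≈-refl ⟩∘⟨ T-∘-split ⟩
      μ ∘ T₁ τ ∘ T₁ (id ⊗₁ f′) ∘ τ′ ∘ (f ⊗₁ id)  ≈⟨ ≈-refl ⟩∘⟨ ≈-refl ⟩∘⟨ extendʳ τ′-naturalʳ ⟩
      μ ∘ T₁ τ ∘ τ′ ∘ (id ⊗₁ f′) ∘ (f ⊗₁ id)     ≈⟨ ≈-refl ⟩∘⟨ ≈-refl ⟩∘⟨ ≈-refl ⟩∘⟨ ⊗-interchange ⟩
      μ ∘ T₁ τ ∘ τ′ ∘ (f ⊗₁ id) ∘ (id ⊗₁ f′)     ≈⟨ ≈-sym assoc³ ⟩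
      (μ ∘ T₁ τ ∘ τ′ ∘ (f ⊗₁ id)) ∘ (id ⊗₁ f′)   ∎
    where open SetoidReasoning (hom-setoid _ _)

  centralCone⇒kleisliCentral : ∀ {X Y} (f : X ⇛ T Y) → IsCentralCone M f → IsKleisliCentral M f
  centralCone⇒kleisliCentral f cone {Y′ = Y′} f′ = begin
      (_ ⊗ᵣ f′) ⊙ (f ⊗ₗ _)                      ≈⟨ ⊙-⊗ᵣ-⊗ₗ f f′ ⟩
      (μ ∘ T₁ τ ∘ τ′ ∘ (f ⊗₁ id)) ∘ (id ⊗₁ f′)  ≈⟨ ≈-sym (cone Y′) ⟩∘⟨ ≈-refl ⟩
      (μ ∘ T₁ τ′ ∘ τ ∘ (f ⊗₁ id)) ∘ (id ⊗₁ f′)  ≈⟨ ≈-sym (⊙-⊗ₗ-⊗ᵣ f f′) ⟩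
      (f ⊗ₗ _) ⊙ (_ ⊗ᵣ f′)                      ∎
    where open SetoidReasoning (hom-setoid _ _)

  kleisliCentral⇒centralCone : ∀ {X Y} (f : X ⇛ T Y) → IsKleisliCentral M f → IsCentralCone M f
  kleisliCentral⇒centralCone f central W = begin
      μ ∘ T₁ τ′ ∘ τ ∘ (f ⊗₁ id)                 ≈⟨ ≈-sym ∘-id⊗id ⟩
      (μ ∘ T₁ τ′ ∘ τ ∘ (f ⊗₁ id)) ∘ (id ⊗₁ id)  ≈⟨ ≈-sym (⊙-⊗ₗ-⊗ᵣ f id) ⟩
      (f ⊗ₗ _) ⊙ (_ ⊗ᵣ id)                      ≈⟨ ≈-sym (central {T W} {W} id) ⟩
      (_ ⊗ᵣ id) ⊙ (f ⊗ₗ _)                      ≈⟨ ⊙-⊗ᵣ-⊗ₗ f id ⟩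
      (μ ∘ T₁ τ ∘ τ′ ∘ (f ⊗₁ id)) ∘ (id ⊗₁ id)  ≈⟨ ∘-id⊗id ⟩
      μ ∘ T₁ τ ∘ τ′ ∘ (f ⊗₁ id)                 ∎
    where open SetoidReasoning (hom-setoid _ _)

mainTheorem2 : ∀ {o ℓ e : Level} (𝒞 : SymmetricMonoidalCategory o ℓ e) (M : StrongMonad 𝒞)
    {X Y : SymmetricMonoidalCategory.Obj 𝒞} (f : _⇒_ 𝒞 X (T₀ M Y)) →
    (IsCentralCone M f → IsKleisliCentral M f) × (IsKleisliCentral M f → IsCentralCone M f)
mainTheorem2 𝒞 M f =
  CentralCones.centralCone⇒kleisliCentral 𝒞 M f , CentralCones.kleisliCentral⇒centralCone 𝒞 M f
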